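{- Let $U\subset\mathcal{T}$ be a finite set of terms in $\mathbf{k}[x_1,\dots,x_n]$ with $x_1<\dots<x_n$, and let $\mathcal{B}_U$ be its Bar Code. Let $t\in U$ and let $x_i$ be a Janet-nonmultiplicative variable for $t$ with respect to $U$. Let $\mathcal{B}^{(i)}_l$ be the $i$-bar of $\mathcal{B}_U$ under $t$, and let $t'$ be any term of $U$ lying over $\mathcal{B}^{(i)}_{l+1}$. Then the bar $\mathcal{B}^{(i)}_{l+1}$ exists and the exponent $k_i$ of the Janet-like nonmultiplicative power $x_i^{k_i}$ of $t$ with respect to $U$ is $$k_i=\deg_i(t')-\deg_i(t).$$
   Context: $\mathcal{T}$ is the set of terms (monomials) $x_1^{\gamma_1}\cdots x_n^{\gamma_n}$, $\deg_h(t)$ is the exponent of $x_h$ in $t$, and $<$ is the lexicographic order induced by $x_1<\dots<x_n$ (compare exponents of $x_n$ first, then $x_{n-1}$, etc.). For a term $t=x_1^{\gamma_1}\cdots x_n^{\gamma_n}$ let $\pi^i(t)=x_i^{\gamma_i}\cdots x_n^{\gamma_n}$. Bar Code of $U$: order $U$ increasingly w.r.t. Lex as $t_1<\dots<t_m$; form the $n\times m$ matrix whose $(i,c)$ entry is $\pi^i(t_c)$. In row $i$, each maximal block of consecutive equal entries is underlined by a segment, called an $i$-bar; the $i$-bars are numbered $\mathcal{B}^{(i)}_1,\dots,\mathcal{B}^{(i)}_{\mu(i)}$ from left to right. A term $t_c$ (or any bar in an upper row) lies over the $i$-bar whose segment covers column $c$; each $i$-bar lies over a unique $(i+1)$-bar.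 Stars: for each $1\le i\le n$, a star is placed to the right of the last bar $\mathcal{B}^{(i)}_{\mu(i)}$; for each $1\le i\le n-1$ and $1\le j\le\mu(i)-1$, if $\mathcal{B}^{(i)}_j$ and $\mathcal{B}^{(i)}_{j+1}$ do not lie over the same $(i+1)$-bar, a star is placed between them. No other stars are placed. Janet multiplicative variables: for $t=x_1^{\alpha_1}\cdots x_n^{\alpha_n}\in U$, the variable $x_j$ is Janet-multiplicative for $t$ w.r.t. $U$ if there is no term in $U$ of the form $x_1^{\beta_1}\cdots x_j^{\beta_j}x_{j+1}^{\alpha_{j+1}}\cdots x_n^{\alpha_n}$ with $\beta_j>\alpha_j$; otherwise it is Janet-nonmultiplicative. Janet-like nonmultiplicative powers: for $u\in U$ and $1\le i\le n$, let $h_i(u,U)=\max\{\deg_i(v): v\in U,\ \deg_j(v)=\deg_j(u)\ \forall j=i+1,\dots,n\}-\deg_i(u)$. If $h_i(u,U)>0$, set $k_i=\min\{\deg_i(v)-\deg_i(u): v\in U,\ \deg_j(v)=\deg_j(u)\ \forall j=i+1,\dots,n,\ \deg_i(v)>\deg_i(u)\}$; then $x_i^{k_i}$ is a nonmultiplicative power of $u$. $NMP(u,U)$ denotes the set of nonmultiplicative powers of $u$. -}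

module Defs where

open import Data.Nat using (ℕ; zero; suc; _<_; _≤_; _∸_)
open import Data.Nat.Properties using (_≟_)
open import Data.Fin using (Fin; toℕ) renaming (_<_ to _<ᶠ_)
open import Data.Vec using (Vec; lookup; tabulate)
open import Data.Vec.Properties using (≡-dec)
open import Data.List using (List; []; _∷_; map)
open import Data.List.Membership.Propositional using (_∈_)
open import Data.List.Relation.Unary.AllPairs using (AllPairs)
open import Data.Maybe using (Maybe; just; nothing)
open import Data.Product using (Σ; _×_; ∃)
open import Data.Empty using (⊥)
open import Relation.Nullary using (¬_; yes; no)
open import Relation.Nullary.Decidable using (⌊_⌋)
open import Relation.Binary.PropositionalEquality using (_≡_)

-- A term x₁^γ₁ ⋯ xₙ^γₙ is its exponent vector; index h : Fin n (0-based)
-- stands for the variable x_{h+1}.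
Term : ℕ → Set
Term n = Vec ℕ n

deg : ∀ {n} → Fin n → Term n → ℕ
deg h t = lookup t h

-- Lex order induced by x₁ < ⋯ < xₙ: compare exponents of xₙ first.
_<lex_ : ∀ {n} → Term n → Term n → Set
_<lex_ {n} s t = Σ (Fin n) λ h → (deg h s < deg h t) × (∀ (j : Fin n) → h <ᶠ j → deg j s ≡ deg j t)

-- A finite set U of terms, listed increasingly w.r.t. Lex (t₁ < ⋯ < t_m).
LexSorted : ∀ {n} → List (Term n) → Set
LexSorted U = AllPairs _<lex_ U

π : ∀ {n} → Fin n → Term n → Term n
π i t = tabulate λ h → if⌊ toℕ h Data.Nat.<? toℕ i ⌋ h
  where
  if⌊_⌋ : ∀ {P : Set} → Relation.Nullary.Dec P → Fin _ → ℕ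
  if⌊ yes _ ⌋ h = 0
  if⌊ no _ ⌋ h = lookup t h

collapse : ∀ {n} → List (Term n) → List (Term n)
collapse [] = []
collapse (x ∷ xs) = x ∷ go x xs
  where
  go : _ → List (Term _) → List (Term _)
  go p [] = []
  go p (y ∷ ys) with ≡-dec _≟_ y p
  ... | yes _ = go p ys
  ... | no _ = y ∷ go y ys

-- Row i of the Bar Code of U (U given Lex-sorted): the i-bars, left to right,
-- each bar recorded by the common entry π^i(t_c) of the block it underlines.
bars : ∀ {n} → Fin n → List (Term n) → List (Term n)
bars i U = collapse (map (π i) U)

nth : ∀ {A : Set} → List A → ℕ → Maybe A
nth [] _ = nothing
nth (x ∷ xs) zero = just x
nth (x ∷ xs) (suc k) = nth xs k

BarExists : ∀ {n} → List (Term n) → Fin n → ℕ → Set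
BarExists U i l = ∃ λ b → nth (bars i U) l ≡ just b

LiesOver : ∀ {n} → List (Term n) → Fin n → Term n → ℕ → Set
LiesOver U i t l = nth (bars i U) l ≡ just (π i t)

SameTail : ∀ {n} → Fin n → Term n → Term n → Set
SameTail {n} i v u = ∀ (j : Fin n) → i <ᶠ j → deg j v ≡ deg j u

JanetMultiplicative : ∀ {n} → List (Term n) → Term n → Fin n → Set
JanetMultiplicative U t i =
  ¬ (∃ λ v → v ∈ U × SameTail i v t × deg i t < deg i v)

JanetNonMultiplicative : ∀ {n} → List (Term n) → Term n → Fin n → Set
JanetNonMultiplicative U t i = ¬ JanetMultiplicative U t i

-- h_i(u,U) > 0 : some v ∈ U with the same tail has larger x_i-degree
-- (equivalently the max in the definition of h_i exceeds deg_i u).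
hPositive : ∀ {n} → List (Term n) → Term n → Fin n → Set
hPositive U u i = ∃ λ v → v ∈ U × SameTail i v u × deg i u < deg i v

-- x_i^k ∈ NMP(u,U): h_i(u,U) > 0 and k is the minimum of
-- deg_i v − deg_i u over v ∈ U with the same tail and deg_i v > deg_i u.
IsNMPExponent : ∀ {n} → List (Term n) → Term n → Fin n → ℕ → Set
IsNMPExponent U u i k =
  hPositive U u i ×
  (∃ λ v → v ∈ U × SameTail i v u × deg i u < deg i v × k ≡ deg i v ∸ deg i u) ×
  (∀ v → v ∈ U → SameTail i v u → deg i u < deg i v → k ≤ deg i v ∸ deg i u)

module Submission where

-- The i-bars are the distinct
-- values π^i(u), u ∈ U, in increasing Lex order: π^i is weakly monotone for
-- Lex, so collapsing the weakly sorted list π^i(t₁),…,π^i(t_m) yields a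
-- strictly sorted list containing every π^i(u).
--   Since x_i is Janet-nonmultiplicative for t, some v ∈ U has the same tail
-- x_{i+1},…,x_n as t and a larger x_i-degree; then π^i(t) < π^i(v), so the
-- bar of v comes after the bar l of t and the bar l+1 exists.  More generally
-- the bar l+1 is the least bar above π^i(t), hence π^i(t) < π^i(t') ≤ π^i(w)
-- for every w ∈ U with the tail of t and deg_i w > deg_i t.
--   Two facts about Lex then finish the proof: terms lying Lex-between two
-- terms that agree above position i agree with them above i (convexity), and
-- among terms agreeing above i, Lex compares the x_i-degrees.  So t' has the
-- tail of t, deg_i t < deg_i t', and deg_i t' ≤ deg_i w for all such w, which
-- says exactly that deg_i t' − deg_i t is the exponent k_i.

open import Defs
open import Data.Nat using (ℕ; zero; suc; _∸_; _≤_; _<_; s≤s)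
open import Data.Nat.Properties
  using (_≟_; <-irrefl; <-trans; <⇒≤; ≤-reflexive; <-≤-trans; ≮⇒≥;
         ∸-monoˡ-≤; n<1+n; <-cmp; m≤n⇒m<n∨m≡n; _<?_)
open import Data.Fin using (Fin; toℕ)
import Data.Fin.Properties as Fin
open import Data.Vec.Properties using (lookup∘tabulate; tabulate∘lookup; tabulate-cong; ≡-dec)
open import Data.List using (List; []; _∷_; map)
open import Data.List.Membership.Propositional using (_∈_; find; lose)
open import Data.List.Membership.Propositional.Properties using (∈-map⁺)
open import Data.List.Relation.Binary.Subset.Propositional using (_⊆_)
open import Data.List.Relation.Unary.Any using (here; there; any?)
open import Data.List.Relation.Unary.All using (All; []; _∷_)
import Data.List.Relation.Unary.All as All
open import Data.List.Relation.Unary.All.Properties using (anti-mono)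
open import Data.List.Relation.Unary.AllPairs using (AllPairs; []; _∷_)
import Data.List.Relation.Unary.AllPairs as AllPairs
open import Data.List.Relation.Unary.AllPairs.Properties using (map⁺)
open import Data.Maybe using (just)
open import Data.Product using (_×_; _,_; ∃)
open import Data.Sum using (_⊎_; inj₁; inj₂)
open import Data.Empty using (⊥-elim)
open import Function using (_∋_)
open import Relation.Nullary using (¬_; yes; no; Dec)
open import Relation.Nullary.Decidable using (_×-dec_; _→-dec_)
open import Relation.Binary.Definitions using (Asymmetric; tri<; tri≈; tri>)
open import Relation.Binary.PropositionalEquality using (_≡_; refl; sym; trans; subst; subst₂)

nth-∈ : ∀ {A : Set} (L : List A) {p a} → nth L p ≡ just a → a ∈ L
nth-∈ (x ∷ xs) {zero}  refl = here refl
nth-∈ (x ∷ xs) {suc p} e    = there (nth-∈ xs e)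

∈-nth : ∀ {A : Set} {L : List A} {a} → a ∈ L → ∃ λ p → nth L p ≡ just a
∈-nth (here refl) = zero , refl
∈-nth (there a∈L) with ∈-nth a∈L
... | p , e = suc p , e

just-injective : ∀ {A : Set} {a b : A} → just a ≡ just b → a ≡ b
just-injective refl = refl

nth-defined-below : ∀ {A : Set} (L : List A) {p q a} → nth L p ≡ just a → q ≤ p →
  ∃ λ b → nth L q ≡ just b
nth-defined-below (x ∷ xs) {q = zero}              _ _         = x , refl
nth-defined-below (x ∷ xs) {p = suc p} {q = suc q} e (s≤s q≤p) = nth-defined-below xs e q≤p

module SortedList {A : Set} {_≺_ : A → A → Set} (≺-asym : Asymmetric _≺_)
                  {L : List A} (sorted : AllPairs _≺_ L) where

  position-order : ∀ {p q a b} → nth L p ≡ just a → nth L q ≡ just b → p < q → a ≺ b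
  position-order = go sorted
    where
    go : ∀ {L : List A} → AllPairs _≺_ L →
      ∀ {p q a b} → nth L p ≡ just a → nth L q ≡ just b → p < q → a ≺ b
    go {x ∷ xs} (x≺xs ∷ _) {zero} {suc q} refl e _ = All.lookup x≺xs (nth-∈ xs e)
    go {x ∷ xs} (_ ∷ xs-sorted) {suc p} {suc q} ea eb (s≤s p<q) = go xs-sorted ea eb p<q

  element-order : ∀ {p q a b} → nth L p ≡ just a → nth L q ≡ just b → a ≺ b → p < q
  element-order {p} {q} ea eb a≺b with <-cmp p q
  ... | tri< p<q _ _ = p<q
  ... | tri≈ _ refl _ = ⊥-elim (≺-asym a≺a a≺a)
    where
    a≺a = subst (_ ≺_) (just-injective (trans (sym eb) ea)) a≺b
  ... | tri> _ _ q<p = ⊥-elim (≺-asym a≺b (position-order eb ea q<p))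

  successor-exists : ∀ {l a c} → nth L l ≡ just a → c ∈ L → a ≺ c → ∃ λ b → nth L (suc l) ≡ just b
  successor-exists ea c∈L a≺c with ∈-nth c∈L
  ... | q , ec = nth-defined-below L ec (element-order ea ec a≺c)

  successor-least : ∀ {l a b c} → nth L l ≡ just a → nth L (suc l) ≡ just b → c ∈ L → a ≺ c →
    b ≡ c ⊎ b ≺ c
  successor-least ea eb c∈L a≺c with ∈-nth c∈L
  ... | q , ec with m≤n⇒m<n∨m≡n (element-order ea ec a≺c)
  ... | inj₁ l+1<q = inj₂ (position-order eb ec l+1<q)
  ... | inj₂ refl  = inj₁ (just-injective (trans (sym eb) ec))

module _ {n : ℕ} where

  _≤lex_ : Term n → Term n → Set
  a ≤lex b = a ≡ b ⊎ a <lex b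

  <lex-trans : ∀ {a b c : Term n} → a <lex b → b <lex c → a <lex c
  <lex-trans {a} {b} {c} (h₁ , a<b , a≡b) (h₂ , b<c , b≡c) with Fin.<-cmp h₁ h₂
  ... | tri< h₁<h₂ _ _ = h₂ , subst (_< deg h₂ c) (sym (a≡b h₂ h₁<h₂)) b<c ,
                           λ j h₂<j → trans (a≡b j (<-trans h₁<h₂ h₂<j)) (b≡c j h₂<j)
  ... | tri≈ _ refl _  = h₁ , <-trans a<b b<c , λ j h<j → trans (a≡b j h<j) (b≡c j h<j)
  ... | tri> _ _ h₂<h₁ = h₁ , subst (deg h₁ a <_) (b≡c h₁ h₂<h₁) a<b ,
                           λ j h₁<j → trans (a≡b j h₁<j) (b≡c j (<-trans h₂<h₁ h₁<j))

  <lex-asym : ∀ {a b : Term n} → a <lex b → ¬ (b <lex a)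
  <lex-asym {a} {b} a<b b<a with <lex-trans {a} {b} {a} a<b b<a
  ... | (_ , a<a , _) = <-irrefl refl a<a

  -- Convexity: if a < b ≤ c in Lex and a, c agree above position h, then so do a, b.
  -- (Otherwise the highest position where a and b differ lies above h, and there
  -- c < b, contradicting b ≤ c.)
  lex-convex : ∀ {a b c : Term n} (h : Fin n) → a <lex b → b ≤lex c → SameTail h c a → SameTail h b a
  lex-convex h _ (inj₁ refl) c≈a = c≈a
  lex-convex {a} {b} {c} h (d , a<b , a≡b) (inj₂ b<c) c≈a j h<j with toℕ d <? toℕ j
  ... | yes d<j = sym (a≡b j d<j)
  ... | no d≮j  = ⊥-elim (<lex-asym {b} {c} b<c (d , c<b , c≡b))
    where
    h<d : toℕ h < toℕ d
    h<d = <-≤-trans h<j (≮⇒≥ d≮j)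
    c<b : deg d c < deg d b
    c<b = subst (_< deg d b) (sym (c≈a d h<d)) a<b
    c≡b : ∀ k → toℕ d < toℕ k → deg k c ≡ deg k b
    c≡b k d<k = trans (c≈a k (<-trans h<d d<k)) (a≡b k d<k)

  lex-top-≤ : ∀ {a b : Term n} (h : Fin n) → SameTail h b a → a ≤lex b → deg h a ≤ deg h b
  lex-top-≤ h _ (inj₁ refl) = ≤-reflexive refl
  lex-top-≤ h b≈a (inj₂ (d , a<b , a≡b)) with Fin.<-cmp d h
  ... | tri< d<h _ _ = ≤-reflexive (a≡b h d<h)
  ... | tri≈ _ refl _ = <⇒≤ a<b
  ... | tri> _ _ h<d = ⊥-elim (<-irrefl (sym (b≈a d h<d)) a<b)

  lex-top-< : ∀ {a b : Term n} (h : Fin n) → SameTail h b a →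
    (∀ (j : Fin n) → toℕ j < toℕ h → deg j a ≡ deg j b) → a <lex b → deg h a < deg h b
  lex-top-< h b≈a below (d , a<b , _) with Fin.<-cmp d h
  ... | tri< d<h _ _ = ⊥-elim (<-irrefl (below d d<h) a<b)
  ... | tri≈ _ refl _ = a<b
  ... | tri> _ _ h<d = ⊥-elim (<-irrefl (sym (b≈a d h<d)) a<b)

  vec-ext : ∀ {u w : Term n} → (∀ h → deg h u ≡ deg h w) → u ≡ w
  vec-ext {u} {w} u≗w = trans (sym (tabulate∘lookup u)) (trans (tabulate-cong u≗w) (tabulate∘lookup w))

  π-below : ∀ (i h : Fin n) (t : Term n) → toℕ h < toℕ i → deg h (π i t) ≡ 0
  π-below i h t h<i with (deg h (π i t) ≡ _ ∋ lookup∘tabulate _ h)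
  ... | e with toℕ h <? toℕ i
  ...   | yes _  = e
  ...   | no h≮i = ⊥-elim (h≮i h<i)

  π-kept : ∀ (i h : Fin n) (t : Term n) → ¬ (toℕ h < toℕ i) → deg h (π i t) ≡ deg h t
  π-kept i h t h≮i with (deg h (π i t) ≡ _ ∋ lookup∘tabulate _ h)
  ... | e with toℕ h <? toℕ i
  ...   | yes h<i = ⊥-elim (h≮i h<i)
  ...   | no _    = e

  π-at : ∀ (i : Fin n) (t : Term n) → deg i (π i t) ≡ deg i t
  π-at i t = π-kept i i t (<-irrefl refl)

  π-above : ∀ (i j : Fin n) (t : Term n) → toℕ i < toℕ j → deg j (π i t) ≡ deg j t
  π-above i j t i<j = π-kept i j t (λ j<i → <-irrefl refl (<-trans i<j j<i))

  SameTail-π : ∀ (i : Fin n) {v u : Term n} → SameTail i v u → SameTail i (π i v) (π i u)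
  SameTail-π i {v} {u} v≈u j i<j = trans (π-above i j v i<j) (trans (v≈u j i<j) (sym (π-above i j u i<j)))

  π-SameTail : ∀ (i : Fin n) {v u : Term n} → SameTail i (π i v) (π i u) → SameTail i v u
  π-SameTail i {v} {u} πv≈πu j i<j = trans (sym (π-above i j v i<j)) (trans (πv≈πu j i<j) (π-above i j u i<j))

  -- π^i is weakly Lex-monotone: a difference below i is erased, one at or above i is kept.
  π-monotone : ∀ (i : Fin n) {s t : Term n} → s <lex t → π i s ≤lex π i t
  π-monotone i {s} {t} (d , s<t , s≡t) with toℕ d <? toℕ i
  ... | yes d<i = inj₁ (vec-ext agree)
    where
    agree : ∀ h → deg h (π i s) ≡ deg h (π i t)
    agree h with toℕ h <? toℕ i
    ... | yes h<i = trans (π-below i h s h<i) (sym (π-below i h t h<i))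
    ... | no h≮i  = trans (π-kept i h s h≮i)
                      (trans (s≡t h (<-≤-trans d<i (≮⇒≥ h≮i))) (sym (π-kept i h t h≮i)))
  ... | no d≮i = inj₂ (d , subst₂ _<_ (sym (π-kept i d s d≮i)) (sym (π-kept i d t d≮i)) s<t ,
                       λ j d<j → let j≮i = λ j<i → d≮i (<-trans d<j j<i) in
                         trans (π-kept i j s j≮i) (trans (s≡t j d<j) (sym (π-kept i j t j≮i))))

  π-raise : ∀ (i : Fin n) {t v : Term n} → SameTail i v t → deg i t < deg i v → π i t <lex π i v
  π-raise i {t} {v} v≈t t<v =
    i , subst₂ _<_ (sym (π-at i t)) (sym (π-at i v)) t<v , λ j i<j → sym (SameTail-π i v≈t j i<j)

  π-top-≤ : ∀ (i : Fin n) {a b : Term n} → SameTail i b a → π i a ≤lex π i b → deg i a ≤ deg i b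
  π-top-≤ i {a} {b} b≈a πa≤πb = subst₂ _≤_ (π-at i a) (π-at i b) (lex-top-≤ i (SameTail-π i b≈a) πa≤πb)

  π-top-< : ∀ (i : Fin n) {a b : Term n} → SameTail i b a → π i a <lex π i b → deg i a < deg i b
  π-top-< i {a} {b} b≈a πa<πb =
    subst₂ _<_ (π-at i a) (π-at i b) (lex-top-< {a = π i a} {b = π i b} i (SameTail-π i b≈a) below πa<πb)
    where
    below : ∀ j → toℕ j < toℕ i → deg j (π i a) ≡ deg j (π i b)
    below j j<i = trans (π-below i j a j<i) (sym (π-below i j b j<i))

  collapse-⊆ : ∀ (p : Term n) ys → collapse (p ∷ ys) ⊆ p ∷ ys
  collapse-⊆ p [] x∈ = x∈
  collapse-⊆ p (y ∷ ys) x∈ with ≡-dec _≟_ y p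
  ... | yes y≡p with collapse-⊆ p ys x∈
  ...   | here x≡p   = here x≡p
  ...   | there x∈ys = there (there x∈ys)
  collapse-⊆ p (y ∷ ys) x∈ | no y≢p with x∈
  ...   | here x≡p = here x≡p
  ...   | there x∈ = there (collapse-⊆ y ys x∈)

  ⊆-collapse : ∀ (p : Term n) ys → p ∷ ys ⊆ collapse (p ∷ ys)
  ⊆-collapse p [] x∈ = x∈
  ⊆-collapse p (y ∷ ys) x∈ with ≡-dec _≟_ y p | x∈
  ... | yes y≡p | here x≡p         = ⊆-collapse p ys (here x≡p)
  ... | yes y≡p | there (here x≡y) = ⊆-collapse p ys (here (trans x≡y y≡p))
  ... | yes y≡p | there (there x∈) = ⊆-collapse p ys (there x∈)
  ... | no y≢p  | here x≡p         = here x≡p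
  ... | no y≢p  | there x∈         = there (⊆-collapse y ys x∈)

  collapse-sorted : ∀ (L : List (Term n)) → AllPairs _≤lex_ L → AllPairs _<lex_ (collapse L)
  collapse-sorted [] _ = []
  collapse-sorted (p ∷ ys) (p≤ys ∷ ys-sorted) = go p ys p≤ys ys-sorted
    where
    strict : ∀ {p y : Term n} → p ≤lex y → ¬ (y ≡ p) → p <lex y
    strict (inj₁ p≡y) y≢p = ⊥-elim (y≢p (sym p≡y))
    strict (inj₂ p<y) _   = p<y
    go : ∀ (p : Term n) ys → All (p ≤lex_) ys → AllPairs _≤lex_ ys → AllPairs _<lex_ (collapse (p ∷ ys))
    go p [] _ _ = [] ∷ []
    go p (y ∷ ys) (p≤y ∷ p≤ys) (y≤ys ∷ ys-sorted) with ≡-dec _≟_ y p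
    ... | yes _ = go p ys p≤ys ys-sorted
    ... | no y≢p =
      anti-mono (collapse-⊆ y ys) (p<y ∷ All.map (λ {z} → <≤-trans {p} {y} {z} p<y) y≤ys) ∷ go y ys y≤ys ys-sorted
      where
      p<y = strict p≤y y≢p
      <≤-trans : ∀ {a b c : Term n} → a <lex b → b ≤lex c → a <lex c
      <≤-trans a<b (inj₁ refl) = a<b
      <≤-trans {a} {b} {c} a<b (inj₂ b<c) = <lex-trans {a} {b} {c} a<b b<c

  bars-sorted : ∀ (i : Fin n) (U : List (Term n)) → LexSorted U → AllPairs _<lex_ (bars i U)
  bars-sorted i U sorted = collapse-sorted (map (π i) U) (map⁺ (AllPairs.map (π-monotone i) sorted))

  bar-of : ∀ (i : Fin n) {U : List (Term n)} {u : Term n} → u ∈ U → π i u ∈ bars i U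
  bar-of i {p ∷ ys} u∈U = ⊆-collapse (π i p) (map (π i) ys) (∈-map⁺ (π i) u∈U)

  -- Having the same tail is decidable, so Janet-nonmultiplicativity yields a witness.
  sameTail? : ∀ (i : Fin n) (v u : Term n) → Dec (SameTail i v u)
  sameTail? i v u = Fin.all? (λ j → (toℕ i <? toℕ j) →-dec (deg j v ≟ deg j u))

  nonMultiplicative⇒hPositive : ∀ (U : List (Term n)) (t : Term n) (i : Fin n) →
    JanetNonMultiplicative U t i → hPositive U t i
  nonMultiplicative⇒hPositive U t i nonMult
    with any? (λ v → sameTail? i v t ×-dec (deg i t <? deg i v)) U
  ... | yes witness = find witness
  ... | no none = ⊥-elim (nonMult λ { (v , v∈U , v≈t , t<v) → none (lose v∈U (v≈t , t<v)) })

proposition21 : ∀ {n} (U : List (Term n)) → LexSorted U →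
    (t : Term n) → t ∈ U → (i : Fin n) → JanetNonMultiplicative U t i →
    (l : ℕ) → LiesOver U i t l →
    BarExists U i (suc l) ×
    (∀ (t' : Term n) → t' ∈ U → LiesOver U i t' (suc l) →
      IsNMPExponent U t i (deg i t' ∸ deg i t))
proposition21 U sorted t _ i nonMult l tOver with nonMultiplicative⇒hPositive U t i nonMult
... | hPos@(v , v∈U , v≈t , t<v) =
  successor-exists tOver (bar-of i v∈U) (π-raise i v≈t t<v) , exponent
  where
  open SortedList (λ {a} {b} → <lex-asym {a = a} {b = b}) (bars-sorted i U sorted)
  exponent : ∀ t' → t' ∈ U → LiesOver U i t' (suc l) → IsNMPExponent U t i (deg i t' ∸ deg i t)
  exponent t' t'∈U t'Over = hPos , (t' , t'∈U , t'≈t , t<t' , refl) , minimal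
    where
    belowCandidate : ∀ {w} → w ∈ U → SameTail i w t → deg i t < deg i w → π i t' ≤lex π i w
    belowCandidate w∈U w≈t t<w = successor-least tOver t'Over (bar-of i w∈U) (π-raise i w≈t t<w)
    -- t' lies on the bar right after that of t, strictly between t and v in
    -- the bar order; hence it has the tail of t and a larger x_i-degree.
    πt<πt' : π i t <lex π i t'
    πt<πt' = position-order tOver t'Over (n<1+n l)
    t'≈t : SameTail i t' t
    t'≈t = π-SameTail i (lex-convex {a = π i t} {b = π i t'} {c = π i v} i
             πt<πt' (belowCandidate v∈U v≈t t<v) (SameTail-π i v≈t))
    t<t' : deg i t < deg i t'
    t<t' = π-top-< i t'≈t πt<πt'
    minimal : ∀ w → w ∈ U → SameTail i w t → deg i t < deg i w → deg i t' ∸ deg i t ≤ deg i w ∸ deg i t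
    minimal w w∈U w≈t t<w = ∸-monoˡ-≤ (deg i t)
      (π-top-≤ i (λ j i<j → trans (w≈t j i<j) (sym (t'≈t j i<j))) (belowCandidate w∈U w≈t t<w))
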